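{- Let $J$ be an ideal on $\omega$. Then $\mathcal{N}_J\preceq_{\mathrm{T}}\mathbf{S}_J$ and $\mathcal{N}^*_J\preceq_{\mathrm{T}}\mathbf{S}_J$. In particular, $\mathfrak{b}_J(\overline{\Omega})\le\min\{\mathrm{add}(\mathcal{N}_J),\mathrm{add}(\mathcal{N}^*_J)\}$ and $\max\{\mathrm{cof}(\mathcal{N}_J),\mathrm{cof}(\mathcal{N}^*_J)\}\le\mathfrak{d}_J(\overline{\Omega})$.
   Context: An ideal on $\omega$ is a family $J\subseteq\mathcal{P}(\omega)$ closed under subsets and finite unions, containing all finite sets, with $\omega\notin J$; $J^+=\mathcal{P}(\omega)\setminus J$, $J^d=\{\omega\setminus a:a\in J\}$. ${}^\omega2$ has Lebesgue measure $\mu$; $\Omega$ is the set of clopen subsets. For $\bar c\in{}^\omega\Omega$: $N(\bar c)=\{x:x\in c_n\text{ for infinitely many }n\}$, $\overline{\Omega}=\{\bar c:\mu(N(\bar c))=0\}$, $N_J(\bar c)=\{x:\{n:x\in c_n\}\in J^+\}$, $N^*_J(\bar c)=\{x:\{n:x\in c_n\}\in J^d\}$, $\mathcal{N}_J=\{X\subseteq{}^\omega2:\exists\bar c\in\overline{\Omega}\ X\subseteq N_J(\bar c)\}$, $\mathcal{N}^*_J=\{X:\exists\bar c\in\overline{\Omega}\ X\subseteq N^*_J(\bar c)\}$. A relational system is $\mathbf{R}=\langle X,Y,R\rangle$; $\mathfrak{b}(\mathbf{R})=\min\{|F|:F\subseteq X,\ \neg\exists y\in Y\,\forall x\in F\ xRy\}$,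 $\mathfrak{d}(\mathbf{R})=\min\{|D|:D\subseteq Y,\ \forall x\in X\,\exists y\in D\ xRy\}$. $\mathbf{R}\preceq_{\mathrm{T}}\mathbf{R}'=\langle X',Y',R'\rangle$ iff there are $\varphi_-:X\to X'$, $\varphi_+:Y'\to Y$ with $\varphi_-(x)R'y'\Rightarrow xR\varphi_+(y')$. An ideal $\mathcal{I}$ is identified with $\langle\mathcal{I},\mathcal{I},\subseteq\rangle$, so $\mathfrak{b}$ and $\mathfrak{d}$ of it are $\mathrm{add}(\mathcal{I})$ and $\mathrm{cof}(\mathcal{I})$. For $\bar c,\bar d\in\overline{\Omega}$, $\bar c\subseteq^J\bar d$ iff $\{n:c_n\not\subseteq d_n\}\in J$; $\mathbf{S}_J=\langle\overline{\Omega},\overline{\Omega},\subseteq^J\rangle$, $\mathfrak{b}_J(\overline{\Omega})=\mathfrak{b}(\mathbf{S}_J)$, $\mathfrak{d}_J(\overline{\Omega})=\mathfrak{d}(\mathbf{S}_J)$. -}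

module Defs where

open import Level using (Level; _⊔_) renaming (suc to lsuc; zero to lzero)
open import Data.Bool using (Bool; true; false)
open import Data.Nat using (ℕ; zero; suc; _<_; _≤_)
open import Data.List using (List; []; _∷_; length)
open import Data.Product using (Σ; proj₁; _×_; _,_; ∃; ∃-syntax)
open import Data.Sum using (_⊎_)
open import Data.Empty using (⊥)
open import Data.Unit using (⊤)
open import Relation.Binary.PropositionalEquality using (_≡_)
open import Relation.Nullary using (¬_)
open import Data.Rational using (ℚ; ½; 1ℚ; 0ℚ; _*_; _+_) renaming (_≤_ to _≤ℚ_)

Subω : Set₁
Subω = ℕ → Set

_⊆ω_ : Subω → Subω → Set
a ⊆ω b = ∀ n → a n → b n

_∪ω_ : Subω → Subω → Subω
(a ∪ω b) n = a n ⊎ b n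

ωset : Subω
ωset _ = ⊤

record Ideal : Set₂ where
  field
    mem          : Subω → Set
    down-closed  : ∀ {a b} → a ⊆ω b → mem b → mem a
    union-closed : ∀ {a b} → mem a → mem b → mem (a ∪ω b)
    -- every finite set belongs to J (finite sets are exactly the bounded ones)
    finite-in    : ∀ (a : Subω) (k : ℕ) → (∀ n → a n → n < k) → mem a
    proper       : ¬ mem ωset

_∈⁺_ : Subω → Ideal → Set
a ∈⁺ J = ¬ Ideal.mem J a

_∈ᵈ_ : Subω → Ideal → Set
a ∈ᵈ J = Ideal.mem J (λ n → ¬ a n)

Cantor : Set
Cantor = ℕ → Bool

_≺_ : List Bool → Cantor → Set
[] ≺ x = ⊤
(b ∷ s) ≺ x = (x 0 ≡ b) × (s ≺ (λ n → x (suc n)))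

-- Ω: clopen subsets of 2^ω, represented as finite unions of basic cylinders [s]
Ω : Set
Ω = List (List Bool)

_∈c_ : Cantor → Ω → Set
x ∈c []      = ⊥
x ∈c (s ∷ c) = (s ≺ x) ⊎ (x ∈c c)

_⊆c_ : Ω → Ω → Set
c ⊆c d = ∀ x → x ∈c c → x ∈c d

pow½ : ℕ → ℚ
pow½ zero    = 1ℚ
pow½ (suc n) = ½ * pow½ n

partialMeasure : (ℕ → List Bool) → ℕ → ℚ
partialMeasure s zero    = 0ℚ
partialMeasure s (suc N) = partialMeasure s N + pow½ (length (s N))

Null : (Cantor → Set) → Set
Null A = ∀ (k : ℕ) → Σ (ℕ → List Bool) λ s →
           (∀ x → A x → ∃[ i ] (s i ≺ x)) ×
           (∀ N → partialMeasure s N ≤ℚ pow½ k)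

Seq : Set
Seq = ℕ → Ω

Nlim : Seq → Cantor → Set
Nlim c x = ∀ m → ∃[ n ] (m ≤ n × x ∈c c n)

ΩBar : Set
ΩBar = Σ Seq λ c → Null (Nlim c)

hits : Seq → Cantor → Subω
hits c x n = x ∈c c n

N_ : Ideal → ΩBar → Cantor → Set
N_ J (c , _) x = hits c x ∈⁺ J

N* : Ideal → ΩBar → Cantor → Set
N* J (c , _) x = hits c x ∈ᵈ J

SetC : Set₁
SetC = Cantor → Set

_⊆C_ : SetC → SetC → Set
X ⊆C Y = ∀ x → X x → Y x

𝒩 : Ideal → SetC → Set
𝒩 J X = ∃[ c ] (X ⊆C N_ J c)

𝒩* : Ideal → SetC → Set
𝒩* J X = ∃[ c ] (X ⊆C N* J c)

record RelSys (a b r : Level) : Set (lsuc (a ⊔ b ⊔ r)) where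
  field
    X : Set a
    Y : Set b
    R : X → Y → Set r

_⪯T_ : ∀ {a b r a' b' r'} → RelSys a b r → RelSys a' b' r' → Set _
𝐑 ⪯T 𝐑' = Σ (RelSys.X 𝐑 → RelSys.X 𝐑') λ φ- → Σ (RelSys.Y 𝐑' → RelSys.Y 𝐑) λ φ+ →
            ∀ x y' → RelSys.R 𝐑' (φ- x) y' → RelSys.R 𝐑 x (φ+ y')

IdealSys : (SetC → Set) → RelSys (lsuc lzero) (lsuc lzero) lzero
IdealSys I = record { X = Σ SetC I ; Y = Σ SetC I ; R = λ A B → proj₁ A ⊆C proj₁ B }

_⊆[_]_ : ΩBar → Ideal → ΩBar → Set
(c , _) ⊆[ J ] (d , _) = Ideal.mem J (λ n → ¬ (c n ⊆c d n))

S : Ideal → RelSys lzero lzero lzero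
S J = record { X = ΩBar ; Y = ΩBar ; R = λ c d → c ⊆[ J ] d }

-- Cardinal invariants, expressed via indexed families.
-- 𝔟(𝐑) ≤ 𝔟(𝐑') is expressed as: every 𝐑'-unbounded family indexed by I
-- yields an 𝐑-unbounded family indexed by the same I.
-- 𝔡(𝐑') ≤ 𝔡(𝐑) : every 𝐑-dominating family indexed by I yields an
-- 𝐑'-dominating family indexed by I.

Unbounded : ∀ {a b r} (𝐑 : RelSys a b r) {I : Set} → (I → RelSys.X 𝐑) → Set (b ⊔ r)
Unbounded 𝐑 F = ¬ (Σ (RelSys.Y 𝐑) λ y → ∀ i → RelSys.R 𝐑 (F i) y)

Dominating : ∀ {a b r} (𝐑 : RelSys a b r) {I : Set} → (I → RelSys.Y 𝐑) → Set (a ⊔ r)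
Dominating 𝐑 D = ∀ x → ∃[ i ] RelSys.R 𝐑 x (D i)

𝔟≤ : ∀ {a b r a' b' r'} → RelSys a b r → RelSys a' b' r' → Set _
𝔟≤ 𝐑 𝐑' = ∀ (I : Set) (F : I → RelSys.X 𝐑') → Unbounded 𝐑' F →
            Σ (I → RelSys.X 𝐑) λ G → Unbounded 𝐑 G

𝔡≤ : ∀ {a b r a' b' r'} → RelSys a b r → RelSys a' b' r' → Set _
𝔡≤ 𝐑 𝐑' = ∀ (I : Set) (D : I → RelSys.Y 𝐑') → Dominating 𝐑' D →
            Σ (I → RelSys.Y 𝐑) λ E → Dominating 𝐑 E

{-# OPTIONS --safe #-}
module Submission where

-- Since membership in a
-- clopen set is decidable, {n : x ∈ c n} ⊆ {n : x ∈ d n} ∪ defects, and dually for the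
-- complements; hence N_J and N*_J are monotone along ⊆^J.  A monotone map d̄ ↦ N(d̄)
-- makes "pick a witness c̄" a Tukey map from the ideal it generates into 𝐒_J, and
-- Tukey reductions transfer unbounded and dominating families.

open import Defs
open import Level using (Level)
open import Data.Product using (_×_; _,_; ∃-syntax)
open import Data.Sum using (inj₁; inj₂)
open import Data.Bool using (Bool)
open import Data.Bool.Properties using (_≟_)
open import Data.List using (List; []; _∷_)
open import Data.Nat using (suc)
open import Data.Unit using (tt)
open import Relation.Nullary using (Dec; yes; no; ¬_)
open import Relation.Nullary.Decidable using (_×-dec_; _⊎-dec_)

_≺?_ : ∀ (s : List Bool) x → Dec (s ≺ x)
[] ≺? x = yes tt
(b ∷ s) ≺? x = (x 0 ≟ b) ×-dec (s ≺? λ n → x (suc n))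

_∈c?_ : ∀ x (c : Ω) → Dec (x ∈c c)
x ∈c? [] = no λ ()
x ∈c? (s ∷ c) = (s ≺? x) ⊎-dec (x ∈c? c)

defects : Seq → Seq → Subω
defects c d n = ¬ (c n ⊆c d n)

misses : Seq → Cantor → Subω
misses c x n = ¬ hits c x n

hits⊆hits∪defects : ∀ c d x → hits c x ⊆ω (hits d x ∪ω defects c d)
hits⊆hits∪defects c d x n x∈c with x ∈c? d n
... | yes x∈d = inj₁ x∈d
... | no  x∉d = inj₂ λ c⊆d → x∉d (c⊆d x x∈c)

misses⊆misses∪defects : ∀ c d x → misses d x ⊆ω (misses c x ∪ω defects c d)
misses⊆misses∪defects c d x n x∉d with x ∈c? c n
... | yes x∈c = inj₂ λ c⊆d → x∉d (c⊆d x x∈c)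
... | no  x∉c = inj₁ x∉c

module _ (J : Ideal) where
  open Ideal J

  ∈⁺-transfer : ∀ {a b e} → a ⊆ω (b ∪ω e) → mem e → a ∈⁺ J → b ∈⁺ J
  ∈⁺-transfer a⊆b∪e e∈J a∉J b∈J = a∉J (down-closed a⊆b∪e (union-closed b∈J e∈J))

  ∈-transfer : ∀ {a b e} → a ⊆ω (b ∪ω e) → mem b → mem e → mem a
  ∈-transfer a⊆b∪e b∈J e∈J = down-closed a⊆b∪e (union-closed b∈J e∈J)

  N-mono : ∀ c d → c ⊆[ J ] d → N_ J c ⊆C N_ J d
  N-mono (c , _) (d , _) c⊆d x = ∈⁺-transfer (hits⊆hits∪defects c d x) c⊆d

  N*-mono : ∀ c d → c ⊆[ J ] d → N* J c ⊆C N* J d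
  N*-mono (c , _) (d , _) c⊆d x x∈N*c =
    ∈-transfer (misses⊆misses∪defects c d x) x∈N*c c⊆d

generated⪯T : {Y : Set} (_≤_ : Y → Y → Set) (cover : Y → SetC) →
              (∀ c d → c ≤ d → cover c ⊆C cover d) →
              IdealSys (λ X → ∃[ c ] (X ⊆C cover c)) ⪯T record { X = Y ; Y = Y ; R = _≤_ }
generated⪯T _≤_ cover cover-mono =
  (λ (_ , c , _) → c) ,
  (λ d → cover d , d , λ _ x∈d → x∈d) ,
  λ (_ , c , X⊆c) d c≤d x x∈X → cover-mono c d c≤d x (X⊆c x x∈X)

module _ {a b r a' b' r' : Level} (𝐑 : RelSys a b r) (𝐑' : RelSys a' b' r') where

  ⪯T⇒𝔟≤ : 𝐑 ⪯T 𝐑' → 𝔟≤ 𝐑' 𝐑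
  ⪯T⇒𝔟≤ (φ- , φ+ , tukey) I F F-unbounded =
    (λ i → φ- (F i)) ,
    λ (y , bounds) → F-unbounded (φ+ y , λ i → tukey (F i) y (bounds i))

  ⪯T⇒𝔡≤ : 𝐑 ⪯T 𝐑' → 𝔡≤ 𝐑 𝐑'
  ⪯T⇒𝔡≤ (φ- , φ+ , tukey) I D D-dominating =
    (λ i → φ+ (D i)) ,
    λ x → let (i , φ-x≤Di) = D-dominating (φ- x) in i , tukey x (D i) φ-x≤Di

theorem5p10 : (J : Ideal) →
    (IdealSys (𝒩 J) ⪯T S J) × (IdealSys (𝒩* J) ⪯T S J)
    -- 𝔟_J(Ω̄) ≤ add(𝒩_J) and 𝔟_J(Ω̄) ≤ add(𝒩*_J)
    × 𝔟≤ (S J) (IdealSys (𝒩 J)) × 𝔟≤ (S J) (IdealSys (𝒩* J))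
    -- cof(𝒩_J) ≤ 𝔡_J(Ω̄) and cof(𝒩*_J) ≤ 𝔡_J(Ω̄)
    × 𝔡≤ (IdealSys (𝒩 J)) (S J) × 𝔡≤ (IdealSys (𝒩* J)) (S J)
theorem5p10 J =
  𝒩⪯S , 𝒩*⪯S ,
  ⪯T⇒𝔟≤ (IdealSys (𝒩 J)) (S J) 𝒩⪯S , ⪯T⇒𝔟≤ (IdealSys (𝒩* J)) (S J) 𝒩*⪯S ,
  ⪯T⇒𝔡≤ (IdealSys (𝒩 J)) (S J) 𝒩⪯S , ⪯T⇒𝔡≤ (IdealSys (𝒩* J)) (S J) 𝒩*⪯S
  where
  𝒩⪯S : IdealSys (𝒩 J) ⪯T S J
  𝒩⪯S = generated⪯T (λ c d → c ⊆[ J ] d) (N_ J) (N-mono J)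

  𝒩*⪯S : IdealSys (𝒩* J) ⪯T S J
  𝒩*⪯S = generated⪯T (λ c d → c ⊆[ J ] d) (N* J) (N*-mono J)
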